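{- Let $G$ be an $n$-node weighted undirected graph, let $\delta$ be a given $h$-approximation of APSP for $G$, and let $\varepsilon>0$ be a constant. One can deterministically compute, in zero rounds of the Congested-Clique model, a sequence of $O(\log n)$ weighted undirected graphs $G_0, G_1, \ldots, G_{O(\log n)}$ over the node set of $G$, each with weighted diameter at most $\lceil 2/\varepsilon\rceil \cdot h^2$, such that if an $l$-approximation $\delta_{G_i}$ of APSP on each $G_i$ is computed, then one can deterministically compute in zero rounds a function $\eta$ satisfying: (1) $\eta(u,v) \ge d_G(u,v)$ for all pairs of nodes $u,v$; and (2) if $u$ and $v$ are connected by some shortest path in $G$ with at most $h$ hops, then $\eta(u,v) < (1+\varepsilon)\, l \cdot d_G(u,v)$.
   Context: Congested-Clique model: there are $n$ nodes with distinct identifiers in $\{1,\dots,n\}$, communicating in synchronous rounds over a complete communication network; in each round every node may send a (possibly different) message of $O(\log n)$ bits to every other node, and local computation is free. Initially each node knows its incident edges in $G$ and their weights; edge weights are polynomially bounded positive integers. $d_G(u,v)$ is the minimum total weight of a $u$–$v$ path; the number of hops of a path is its number of edges; the weighted diameter of a graph is the maximum distance between two of its nodes. An $\alpha$-approximation of APSP on a graph $F$ is a function $\gamma$ with $d_F(u,v)\le\gamma(u,v)\le\alpha\, d_F(u,v)$ for all $u,v$, where each node $u$ knows $\gamma(u,v)$ for all $v$. The graphs $G_i$ and approximations $\delta_{G_i}$ are known in the sense that each node $u$ knows its incident edges in each $G_i$ and the values $\delta_{G_i}(u,v)$ for all $v$; the computed $\eta(u,v)$ is known to $u$. -}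

module Defs where

open import Data.Nat as ℕ using (ℕ; zero; suc; _+_; _*_; _≤_)
open import Data.Integer as ℤ using (ℤ; +_)
open import Data.Fin using (Fin)
open import Data.Maybe using (Maybe; just; nothing)
open import Data.Product using (Σ; _×_; ∃)
open import Data.Rational as ℚ using (ℚ; Positive)
open import Data.Rational.Properties using (pos⇒nonZero)
open import Relation.Binary.PropositionalEquality using (_≡_)

toℚ : ℕ → ℚ
toℚ d = + d ℚ./ 1

-- A weighted graph on node set Fin n: G u v = just w  iff  {u,v} is an edge of weight w.
WGraph : ℕ → Set
WGraph n = Fin n → Fin n → Maybe ℕ

IsWUGraph : ∀ {n} → WGraph n → Set
IsWUGraph {n} G =
  (∀ (u v : Fin n) → G u v ≡ G v u) ×
  (∀ (u : Fin n) → G u u ≡ nothing) ×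
  (∀ (u v : Fin n) (w : ℕ) → G u v ≡ just w → 1 ≤ w)

data Walk {n : ℕ} (G : WGraph n) : Fin n → Fin n → Set where
  []   : ∀ {u} → Walk G u u
  step : ∀ {u v x} (w : ℕ) → G u v ≡ just w → Walk G v x → Walk G u x

weight : ∀ {n} {G : WGraph n} {u v} → Walk G u v → ℕ
weight []             = 0
weight (step w _ p)   = w + weight p

hops : ∀ {n} {G : WGraph n} {u v} → Walk G u v → ℕ
hops []           = 0
hops (step _ _ p) = suc (hops p)

IsDist : ∀ {n} → WGraph n → Fin n → Fin n → ℕ → Set
IsDist G u v d = Σ (Walk G u v) (λ p → weight p ≡ d) × (∀ (p : Walk G u v) → d ≤ weight p)

Connected : ∀ {n} → WGraph n → Set
Connected {n} G = ∀ (u v : Fin n) → ∃ (λ d → IsDist G u v d)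

DiamAtMost : ∀ {n} → WGraph n → ℕ → Set
DiamAtMost {n} G D = ∀ (u v : Fin n) → ∃ (λ d → IsDist G u v d × d ≤ D)

IsApprox : ∀ {n} → ℚ → WGraph n → (Fin n → Fin n → ℚ) → Set
IsApprox {n} α G γ = ∀ (u v : Fin n) (d : ℕ) → IsDist G u v d →
  (toℚ d ℚ.≤ γ u v) × (γ u v ℚ.≤ α ℚ.* toℚ d)

WeightsBounded : ∀ {n} → ℕ → WGraph n → Set
WeightsBounded {n} c G = ∀ (u v : Fin n) (w : ℕ) → G u v ≡ just w → w ≤ n ℕ.^ c

ceil2/ : (ε : ℚ) → .{{_ : Positive ε}} → ℕ
ceil2/ ε = ℤ.∣ ℚ.ceiling (ℚ._÷_ (+ 2 ℚ./ 1) ε {{pos⇒nonZero ε}}) ∣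

-- Local knowledge of node u before any communication (zero rounds):
-- its identifier, its incident edges in G (row G u), and δ(u,·).
-- A deterministic zero-round rule producing u's incident edges in one graph G_i:
EdgeRule : ℕ → Set
EdgeRule n = Fin n → (Fin n → Maybe ℕ) → (Fin n → ℚ) → (Fin n → Maybe ℕ)

ruleGraph : ∀ {n} → EdgeRule n → WGraph n → (Fin n → Fin n → ℚ) → WGraph n
ruleGraph E G δ u v = E u (G u) (δ u) v

-- A deterministic zero-round rule for computing η(u,·) at node u from its local
-- knowledge: its identifier, row G u, δ(u,·), and δ_{G_i}(u,·) for every i < k.
-- (u's incident edges in the G_i are determined by the edge rules, hence also known.)
OutRule : ℕ → ℕ → Set
OutRule n k = Fin n → (Fin n → Maybe ℕ) → (Fin n → ℚ) → (Fin k → Fin n → ℚ) → (Fin n → ℚ)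

-- Fix B = ⌈2/ε⌉ h² and, for each scale j ≤ c (1 + ⌊log₂ n⌋), let G_j be the complete graph in which
-- an edge of weight w gets weight ⌈w/2^j⌉ capped at B and a non-edge gets weight B; so diam G_j ≤ B.
-- A G_j-walk of weight below B lifts to a G-walk at most 2^j times as heavy, hence d ≤ 2^j d_j as soon
-- as δ(u,v) ≤ 2^j B. A shortest path of at most h hops loses at most 2^j − 1 per edge to rounding, hence
-- 2^j d_j ≤ d + h (2^j − 1). Taking the least j with δ(u,v) ≤ 2^j B, the failure of j − 1 gives
-- h d ≥ δ(u,v) > 2^(j−1) B, so h (2^j − 1) < ε d and η = 2^j δ_{G_j}(u,v) < (1 + ε) l d.
-- Polynomially bounded weights make h d ≤ 2^j B at the last scale, so such a j always exists.

module Submission where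

open import Defs
open import Data.Nat using (ℕ; suc; _*_; _≤_)
open import Data.Nat.Logarithm using (⌊log₂_⌋)
open import Data.Fin using (Fin)
open import Data.Product using (Σ; _×_; ∃; ∃-syntax)
open import Data.Rational as ℚ using (ℚ; Positive; 1ℚ)
open import Relation.Binary.PropositionalEquality using (_≡_; _≢_)

open import Data.Bool using (Bool; true; false)
open import Data.Empty using (⊥-elim)
open import Data.Fin as Fin using (_≟_; toℕ)
open import Data.Integer as ℤ using (+_; -[1+_])
import Data.Integer.DivMod as ℤ
import Data.Integer.Properties as ℤ
open import Data.Maybe as Maybe using (Maybe; just; nothing)
open import Data.Maybe.Relation.Unary.Any using (just; drop-just) renaming (Any to Holds)
open import Data.Nat as ℕ using (zero; _+_; _∸_; _^_; _⊓_; _⊔_; _<_; z≤n; s≤s; NonZero; _≤?_)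
open import Data.Nat.DivMod using (_/_; _%_; m≡m%n+[m/n]*n; m%n<n; m/n*n≤m)
open import Data.Nat.Logarithm using (⌊log₂⌋-mono-≤; ⌊log₂[2^n]⌋≡n)
import Data.Nat.Properties as ℕ
import Data.Nat.Coprimality as Coprimality
open import Data.Nat.Solver using (module +-*-Solver)
open import Data.Product using (_,_; proj₁; proj₂)
open import Data.Rational using (mkℚ; ↥_; ↧_)
import Data.Rational.Properties as ℚ
import Data.Rational.Solver as ℚ-Solver
open import Data.Sum using (_⊎_; inj₁; inj₂; [_,_]′)
open import Function using (_∘_)
open import Relation.Nullary using (yes; no; ¬_; does)
open import Relation.Nullary.Decidable using (dec-true; dec-false)
open import Relation.Unary using (Decidable)
open import Relation.Binary.PropositionalEquality using (refl; sym; trans; cong; cong₂; subst; subst₂; module ≡-Reasoning)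

-- Arithmetic

/1≡mkℚ : ∀ i → i ℚ./ 1 ≡ mkℚ i 0 (Coprimality.sym (Coprimality.1-coprimeTo ℤ.∣ i ∣))
/1≡mkℚ i = ℚ.↥p/↧p≡p (mkℚ i 0 _)

/1-mono-≤ : ∀ {i j} → i ℤ.≤ j → i ℚ./ 1 ℚ.≤ j ℚ./ 1
/1-mono-≤ {i} {j} i≤j rewrite /1≡mkℚ i | /1≡mkℚ j =
  ℚ.*≤* (subst₂ ℤ._≤_ (sym (ℤ.*-identityʳ i)) (sym (ℤ.*-identityʳ j)) i≤j)

/1-mono-< : ∀ {i j} → i ℤ.< j → i ℚ./ 1 ℚ.< j ℚ./ 1
/1-mono-< {i} {j} i<j rewrite /1≡mkℚ i | /1≡mkℚ j =
  ℚ.*<* (subst₂ ℤ._<_ (sym (ℤ.*-identityʳ i)) (sym (ℤ.*-identityʳ j)) i<j)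

/1-cancel-≤ : ∀ {i j} → i ℚ./ 1 ℚ.≤ j ℚ./ 1 → i ℤ.≤ j
/1-cancel-≤ {i} {j} le rewrite /1≡mkℚ i | /1≡mkℚ j =
  subst₂ ℤ._≤_ (ℤ.*-identityʳ i) (ℤ.*-identityʳ j) (ℚ.drop-*≤* le)

/1-cancel-< : ∀ {i j} → i ℚ./ 1 ℚ.< j ℚ./ 1 → i ℤ.< j
/1-cancel-< {i} {j} lt rewrite /1≡mkℚ i | /1≡mkℚ j =
  subst₂ ℤ._<_ (ℤ.*-identityʳ i) (ℤ.*-identityʳ j) (ℚ.drop-*<* lt)

toℚ-mono-≤ : ∀ {m n} → m ≤ n → toℚ m ℚ.≤ toℚ n
toℚ-mono-≤ m≤n = /1-mono-≤ (ℤ.+≤+ m≤n)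

toℚ-mono-< : ∀ {m n} → m < n → toℚ m ℚ.< toℚ n
toℚ-mono-< m<n = /1-mono-< (ℤ.+<+ m<n)

toℚ-cancel-≤ : ∀ {m n} → toℚ m ℚ.≤ toℚ n → m ≤ n
toℚ-cancel-≤ le = ℤ.drop‿+≤+ (/1-cancel-≤ le)

toℚ-cancel-< : ∀ {m n} → toℚ m ℚ.< toℚ n → m < n
toℚ-cancel-< lt = ℤ.drop‿+<+ (/1-cancel-< lt)

toℚ-+ : ∀ m n → toℚ (m + n) ≡ toℚ m ℚ.+ toℚ n
toℚ-+ m n = begin
  + (m + n) ℚ./ 1                       ≡⟨ cong (ℚ._/ 1) (ℤ.pos-+ m n) ⟩
  (+ m ℤ.+ + n) ℚ./ 1                   ≡⟨ cong₂ (λ i j → (i ℤ.+ j) ℚ./ 1) (ℤ.*-identityʳ (+ m)) (ℤ.*-identityʳ (+ n)) ⟨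
  (+ m ℤ.* + 1 ℤ.+ + n ℤ.* + 1) ℚ./ 1   ≡⟨ cong₂ ℚ._+_ (/1≡mkℚ (+ m)) (/1≡mkℚ (+ n)) ⟨
  toℚ m ℚ.+ toℚ n                       ∎
  where open ≡-Reasoning

toℚ-* : ∀ m n → toℚ (m * n) ≡ toℚ m ℚ.* toℚ n
toℚ-* m n = begin
  + (m * n) ℚ./ 1       ≡⟨ cong (ℚ._/ 1) (ℤ.pos-* m n) ⟩
  (+ m ℤ.* + n) ℚ./ 1   ≡⟨ cong₂ ℚ._*_ (/1≡mkℚ (+ m)) (/1≡mkℚ (+ n)) ⟨
  toℚ m ℚ.* toℚ n       ∎
  where open ≡-Reasoning

toℚ-nonNeg : ∀ m → ℚ.NonNegative (toℚ m)
toℚ-nonNeg m = ℚ.nonNegative (toℚ-mono-≤ {0} {m} z≤n)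

toℚ-pos : ∀ {m} → 1 ≤ m → Positive (toℚ m)
toℚ-pos 1≤m = ℚ.positive (toℚ-mono-< 1≤m)

i≤+∣i∣ : ∀ i → i ℤ.≤ + ℤ.∣ i ∣
i≤+∣i∣ (+ n)    = ℤ.≤-refl
i≤+∣i∣ -[1+ n ] = ℤ.-≤+

floor*↧≤↥ : ∀ p → ℚ.floor p ℤ.* ↧ p ℤ.≤ ↥ p
floor*↧≤↥ (mkℚ n d _) = ℤ.[n/d]*d≤n n (+ suc d)

≤-ceiling : ∀ p → p ℚ.≤ ℚ.ceiling p ℚ./ 1
≤-ceiling p@record{} rewrite /1≡mkℚ (ℚ.ceiling p) = ℚ.*≤* (begin
  ↥ p ℤ.* + 1                           ≡⟨ ℤ.*-identityʳ (↥ p) ⟩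
  ↥ p                                   ≡⟨ ℤ.neg-involutive (↥ p) ⟨
  ℤ.- ℤ.- ↥ p                           ≡⟨ cong ℤ.-_ (ℚ.↥-neg p) ⟨
  ℤ.- ↥ (ℚ.- p)                         ≤⟨ ℤ.neg-mono-≤ (floor*↧≤↥ (ℚ.- p)) ⟩
  ℤ.- (ℚ.floor (ℚ.- p) ℤ.* ↧ (ℚ.- p))   ≡⟨ cong (λ d → ℤ.- (ℚ.floor (ℚ.- p) ℤ.* d)) (ℚ.↧-neg p) ⟩
  ℤ.- (ℚ.floor (ℚ.- p) ℤ.* ↧ p)         ≡⟨ ℤ.neg-distribˡ-* (ℚ.floor (ℚ.- p)) (↧ p) ⟩
  ℚ.ceiling p ℤ.* ↧ p                   ∎)
  where open ℤ.≤-Reasoning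

≤-∣ceiling∣ : ∀ p → p ℚ.≤ toℚ ℤ.∣ ℚ.ceiling p ∣
≤-∣ceiling∣ p = ℚ.≤-trans (≤-ceiling p) (/1-mono-≤ (i≤+∣i∣ (ℚ.ceiling p)))

2≤ε*ceil2/ : ∀ ε .{{_ : Positive ε}} → toℚ 2 ℚ.≤ ε ℚ.* toℚ (ceil2/ ε)
2≤ε*ceil2/ ε = begin
  toℚ 2                  ≡⟨ ε*[2÷ε]≡2 ⟨
  ε ℚ.* (toℚ 2 ℚ.÷ ε)    ≤⟨ ℚ.*-monoˡ-≤-nonNeg ε (≤-∣ceiling∣ (toℚ 2 ℚ.÷ ε)) ⟩
  ε ℚ.* toℚ (ceil2/ ε)   ∎
  where
  open ℚ.≤-Reasoning
  instance
    ε≢0 : ℚ.NonZero ε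
    ε≢0 = ℚ.pos⇒nonZero ε
    ε≥0 : ℚ.NonNegative ε
    ε≥0 = ℚ.pos⇒nonNeg ε
  ε*[2÷ε]≡2 : ε ℚ.* (toℚ 2 ℚ.÷ ε) ≡ toℚ 2
  ε*[2÷ε]≡2 = begin-equality
    ε ℚ.* (toℚ 2 ℚ.* ℚ.1/ ε)   ≡⟨ cong (ε ℚ.*_) (ℚ.*-comm (toℚ 2) (ℚ.1/ ε)) ⟩
    ε ℚ.* (ℚ.1/ ε ℚ.* toℚ 2)   ≡⟨ ℚ.*-assoc ε (ℚ.1/ ε) (toℚ 2) ⟨
    (ε ℚ.* ℚ.1/ ε) ℚ.* toℚ 2   ≡⟨ cong (ℚ._* toℚ 2) (ℚ.*-inverseʳ ε) ⟩
    1ℚ ℚ.* toℚ 2               ≡⟨ ℚ.*-identityˡ (toℚ 2) ⟩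
    toℚ 2                      ∎

1≤ceil2/ : ∀ ε .{{_ : Positive ε}} → 1 ≤ ceil2/ ε
1≤ceil2/ ε = positive-factor (ceil2/ ε) (2≤ε*ceil2/ ε)
  where
  positive-factor : ∀ m → toℚ 2 ℚ.≤ ε ℚ.* toℚ m → 1 ≤ m
  positive-factor (suc _) _     = s≤s z≤n
  positive-factor zero    2≤ε*0 =
    ⊥-elim (ℕ.<⇒≱ (s≤s z≤n) (toℚ-cancel-≤ {2} {0} (ℚ.≤-trans 2≤ε*0 (ℚ.≤-reflexive (ℚ.*-zeroʳ ε)))))

⌈_/_⌉ : ℕ → (n : ℕ) → .{{NonZero n}} → ℕ
⌈ m / n ⌉ = (m + (n ∸ 1)) / n

n*⌈m/n⌉≤m+[n∸1] : ∀ m n .{{_ : NonZero n}} → n * ⌈ m / n ⌉ ≤ m + (n ∸ 1)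
n*⌈m/n⌉≤m+[n∸1] m n = ℕ.≤-trans (ℕ.≤-reflexive (ℕ.*-comm n ⌈ m / n ⌉)) (m/n*n≤m (m + (n ∸ 1)) n)

m≤n*⌈m/n⌉ : ∀ m n .{{_ : NonZero n}} → m ≤ n * ⌈ m / n ⌉
m≤n*⌈m/n⌉ m n = ℕ.+-cancelʳ-≤ (n ∸ 1) m (n * ⌈ m / n ⌉) (begin
  m + (n ∸ 1)                        ≡⟨ m≡m%n+[m/n]*n (m + (n ∸ 1)) n ⟩
  (m + (n ∸ 1)) % n + ⌈ m / n ⌉ * n   ≤⟨ ℕ.+-monoˡ-≤ _ (ℕ.∸-monoˡ-≤ 1 (m%n<n (m + (n ∸ 1)) n)) ⟩
  (n ∸ 1) + ⌈ m / n ⌉ * n             ≡⟨ ℕ.+-comm (n ∸ 1) _ ⟩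
  ⌈ m / n ⌉ * n + (n ∸ 1)             ≡⟨ cong (_+ (n ∸ 1)) (ℕ.*-comm ⌈ m / n ⌉ n) ⟩
  n * ⌈ m / n ⌉ + (n ∸ 1)             ∎)
  where open ℕ.≤-Reasoning

1≤⌈m/n⌉ : ∀ {m} n .{{_ : NonZero n}} → 1 ≤ m → 1 ≤ ⌈ m / n ⌉
1≤⌈m/n⌉ {m} n 1≤m with ⌈ m / n ⌉ | m≤n*⌈m/n⌉ m n
... | suc _ | _     = s≤s z≤n
... | zero  | m≤n*0 = ⊥-elim (ℕ.<⇒≱ 1≤m (ℕ.≤-trans m≤n*0 (ℕ.≤-reflexive (ℕ.*-zeroʳ n))))

n<2^[1+⌊log₂n⌋] : ∀ n → n < 2 ^ suc ⌊log₂ n ⌋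
n<2^[1+⌊log₂n⌋] n with n ℕ.<? 2 ^ suc ⌊log₂ n ⌋
... | yes n< = n<
... | no  n≮ = ⊥-elim (ℕ.n≮n ⌊log₂ n ⌋ (begin-strict
  ⌊log₂ n ⌋                       <⟨ ℕ.n<1+n ⌊log₂ n ⌋ ⟩
  suc ⌊log₂ n ⌋                   ≡⟨ ⌊log₂[2^n]⌋≡n (suc ⌊log₂ n ⌋) ⟨
  ⌊log₂ (2 ^ suc ⌊log₂ n ⌋) ⌋      ≤⟨ ⌊log₂⌋-mono-≤ (ℕ.≮⇒≥ n≮) ⟩
  ⌊log₂ n ⌋                       ∎))
  where open ℕ.≤-Reasoning

n^c≤2^[c*[1+⌊log₂n⌋]] : ∀ n c → n ^ c ≤ 2 ^ (c * suc ⌊log₂ n ⌋)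
n^c≤2^[c*[1+⌊log₂n⌋]] n c = begin
  n ^ c                            ≤⟨ ℕ.^-monoˡ-≤ c (ℕ.<⇒≤ (n<2^[1+⌊log₂n⌋] n)) ⟩
  (2 ^ suc ⌊log₂ n ⌋) ^ c          ≡⟨ ℕ.^-*-assoc 2 (suc ⌊log₂ n ⌋) c ⟩
  2 ^ (suc ⌊log₂ n ⌋ * c)          ≡⟨ cong (2 ^_) (ℕ.*-comm (suc ⌊log₂ n ⌋) c) ⟩
  2 ^ (c * suc ⌊log₂ n ⌋)          ∎
  where open ℕ.≤-Reasoning

*[a+x]<[1+ε]*l*a : ∀ ε {l a x} .{{_ : Positive l}} → x ℚ.< ε ℚ.* a →
  l ℚ.* (a ℚ.+ x) ℚ.< (1ℚ ℚ.+ ε) ℚ.* l ℚ.* a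
*[a+x]<[1+ε]*l*a ε {l} {a} {x} x<εa = begin-strict
  l ℚ.* (a ℚ.+ x)             <⟨ ℚ.*-monoʳ-<-pos l (ℚ.+-monoʳ-< a x<εa) ⟩
  l ℚ.* (a ℚ.+ ε ℚ.* a)       ≡⟨ solve 3 (λ l a ε → l :* (a :+ ε :* a) := (con 1ℚ :+ ε) :* l :* a) refl l a ε ⟩
  (1ℚ ℚ.+ ε) ℚ.* l ℚ.* a      ∎
  where
  open ℚ.≤-Reasoning
  open ℚ-Solver.+-*-Solver

-- Shortest walks

module Lightest {A : Set} (μ : A → ℕ) where

  Below : ℕ → Maybe A → Set
  Below k = Holds (λ a → μ a ≤ k)

  _⊓ᴹ_ : Maybe A → Maybe A → Maybe A
  nothing ⊓ᴹ y      = y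
  just a ⊓ᴹ nothing = just a
  just a ⊓ᴹ just b with μ a ≤? μ b
  ... | yes _ = just a
  ... | no  _ = just b

  ⨅ : ∀ m → (Fin m → Maybe A) → Maybe A
  ⨅ zero    f = nothing
  ⨅ (suc m) f = f Fin.zero ⊓ᴹ ⨅ m (f ∘ Fin.suc)

  ⊓ᴹ-belowˡ : ∀ {k} x y → Below k x → Below k (x ⊓ᴹ y)
  ⊓ᴹ-belowˡ (just a) nothing  a≤k        = a≤k
  ⊓ᴹ-belowˡ (just a) (just b) (just a≤k) with μ a ≤? μ b
  ... | yes _   = just a≤k
  ... | no  a≰b = just (ℕ.≤-trans (ℕ.<⇒≤ (ℕ.≰⇒> a≰b)) a≤k)

  ⊓ᴹ-belowʳ : ∀ {k} x y → Below k y → Below k (x ⊓ᴹ y)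
  ⊓ᴹ-belowʳ nothing  y        b≤k        = b≤k
  ⊓ᴹ-belowʳ (just a) (just b) (just b≤k) with μ a ≤? μ b
  ... | yes a≤b = just (ℕ.≤-trans a≤b b≤k)
  ... | no  _   = just b≤k

  ⨅-below : ∀ {k} m f (i : Fin m) → Below k (f i) → Below k (⨅ m f)
  ⨅-below (suc m) f Fin.zero    b = ⊓ᴹ-belowˡ (f Fin.zero) _ b
  ⨅-below (suc m) f (Fin.suc i) b = ⊓ᴹ-belowʳ (f Fin.zero) _ (⨅-below m (f ∘ Fin.suc) i b)

module _ {n} (G : WGraph n) where

  private
    module L {u v : Fin n} = Lightest (weight {G = G} {u} {v})

  prepend : ∀ {u x v} (r : Maybe ℕ) → G u x ≡ r → Maybe (Walk G x v) → Maybe (Walk G u v)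
  prepend (just w) e q = Maybe.map (step w e) q
  prepend nothing  _ _ = nothing

  prepend-below : ∀ {u x v w k} (r : Maybe ℕ) (e : G u x ≡ r) → r ≡ just w →
    (q : Maybe (Walk G x v)) → L.Below k q → L.Below (w + k) (prepend r e q)
  prepend-below (just w) e refl (just q) (just q≤k) = just (ℕ.+-monoʳ-≤ w q≤k)

  -- Bellman–Ford over walks rather than weights, so that what it returns is a walk by construction.
  lightestWalk : ℕ → ∀ u v → Maybe (Walk G u v)
  lightestWalk zero    u v with u ≟ v
  ... | yes refl = just []
  ... | no  _    = nothing
  lightestWalk (suc k) u v =
    lightestWalk k u v L.⊓ᴹ L.⨅ n (λ x → prepend (G u x) refl (lightestWalk k x v))

  lightestWalk-optimal : ∀ k {u v} (p : Walk G u v) → hops p ≤ k →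
    L.Below (weight p) (lightestWalk k u v)
  lightestWalk-optimal zero {u} [] _ with u ≟ u
  ... | yes refl = just z≤n
  ... | no  u≢u  = ⊥-elim (u≢u refl)
  lightestWalk-optimal (suc k) [] _ =
    L.⊓ᴹ-belowˡ (lightestWalk k _ _) _ (lightestWalk-optimal k [] z≤n)
  lightestWalk-optimal (suc k) {u} {v} (step {v = x} w e p) (s≤s hops≤k) =
    L.⊓ᴹ-belowʳ (lightestWalk k u v) _
      (L.⨅-below n (λ y → prepend (G u y) refl (lightestWalk k y v)) x
        (prepend-below (G u x) refl e (lightestWalk k x v) (lightestWalk-optimal k p hops≤k)))

  module _ (positive : ∀ u v w → G u v ≡ just w → 1 ≤ w) where

    hops≤weight : ∀ {u v} (p : Walk G u v) → hops p ≤ weight p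
    hops≤weight []                   = z≤n
    hops≤weight (step {u} {v} w e p) = ℕ.+-mono-≤ (positive u v w e) (hops≤weight p)

    weight-pos : ∀ {u v} → u ≢ v → (p : Walk G u v) → 1 ≤ weight p
    weight-pos u≢v []                   = ⊥-elim (u≢v refl)
    weight-pos u≢v (step {u} {v} w e p) = ℕ.≤-trans (positive u v w e) (ℕ.m≤m+n w (weight p))

    -- Positive weights bound the hops of every walk lighter than q by weight q.
    distance : ∀ {u v} (q : Walk G u v) → ∃ λ d → IsDist G u v d × d ≤ weight q
    distance {u} {v} q
      with lightestWalk (weight q) u v in eq | lightestWalk-optimal (weight q) q (hops≤weight q)
    ... | just r | just r≤q = weight r , ((r , refl) , r-minimal) , r≤q
      where
      r-minimal : ∀ p → weight r ≤ weight p
      r-minimal p with weight p ≤? weight q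
      ... | yes p≤q = drop-just (subst (L.Below (weight p)) eq
                        (lightestWalk-optimal (weight q) p (ℕ.≤-trans (hops≤weight p) p≤q)))
      ... | no  p≰q = ℕ.≤-trans r≤q (ℕ.<⇒≤ (ℕ.≰⇒> p≰q))

  weight≤hops*max : ∀ {M} → (∀ u v w → G u v ≡ just w → w ≤ M) → ∀ {u v} (p : Walk G u v) → weight p ≤ hops p * M
  weight≤hops*max bounded []                   = z≤n
  weight≤hops*max bounded (step {u} {v} w e p) = ℕ.+-mono-≤ (bounded u v w e) (weight≤hops*max bounded p)

  distance-pos : IsWUGraph G → ∀ {u v d} → u ≢ v → IsDist G u v d → 1 ≤ d
  distance-pos (_ , _ , positive) u≢v ((p , refl) , _) = weight-pos positive u≢v p

  approx-factor≥1 : ∀ {α γ} → IsApprox α G γ → ∀ {u v d} → IsDist G u v d → 1 ≤ d → 1ℚ ℚ.≤ α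
  approx-factor≥1 {α} {γ} approx {u} {v} {d} u-v 1≤d =
    ℚ.*-cancelʳ-≤-pos (toℚ d) {{toℚ-pos 1≤d}} (begin
      1ℚ ℚ.* toℚ d   ≡⟨ ℚ.*-identityˡ (toℚ d) ⟩
      toℚ d          ≤⟨ proj₁ (approx u v d u-v) ⟩
      γ u v          ≤⟨ proj₂ (approx u v d u-v) ⟩
      α ℚ.* toℚ d    ∎)
    where open ℚ.≤-Reasoning

-- The rescaled graphs

does-≟-comm : ∀ {n} (u v : Fin n) → does (u ≟ v) ≡ does (v ≟ u)
does-≟-comm u v with u ≟ v | v ≟ u
... | yes _   | yes _   = refl
... | no  _   | no  _   = refl
... | yes u≡v | no  v≢u = ⊥-elim (v≢u (sym u≡v))
... | no  u≢v | yes v≡u = ⊥-elim (u≢v (sym v≡u))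

-- The paper's G_i, for ρ = 2^i. The cap is B ⊔ 1 rather than B so that weights stay positive when h = 0.
module Rescaled (B ρ : ℕ) .{{_ : NonZero ρ}} where

  cap : ℕ
  cap = B ⊔ 1

  rescaledEdge : Bool → Maybe ℕ → Maybe ℕ
  rescaledEdge true  _        = nothing
  rescaledEdge false (just w) = just (⌈ w / ρ ⌉ ⊓ cap)
  rescaledEdge false nothing  = just cap

  rescaledRule : ∀ {n} → EdgeRule n
  rescaledRule u row _ v = rescaledEdge (does (u ≟ v)) (row v)

  rescaledEdge-pos : ∀ b m {w′} → (∀ w → m ≡ just w → 1 ≤ w) → rescaledEdge b m ≡ just w′ → 1 ≤ w′
  rescaledEdge-pos false (just w) pos refl = ℕ.⊓-glb (1≤⌈m/n⌉ ρ (pos w refl)) (ℕ.m≤n⊔m B 1)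
  rescaledEdge-pos false nothing  pos refl = ℕ.m≤n⊔m B 1

  rescaledEdge-≤cap : ∀ m → ∃ λ w′ → rescaledEdge false m ≡ just w′ × w′ ≤ cap
  rescaledEdge-≤cap (just w) = _ , refl , ℕ.m⊓n≤n ⌈ w / ρ ⌉ cap
  rescaledEdge-≤cap nothing  = cap , refl , ℕ.≤-refl

  rescaledEdge-lift : ∀ b m {w′} → rescaledEdge b m ≡ just w′ →
    B ≤ w′ ⊎ ∃ λ w → m ≡ just w × w ≤ ρ * w′
  rescaledEdge-lift false nothing  refl = inj₁ (ℕ.m≤m⊔n B 1)
  rescaledEdge-lift false (just w) refl with ℕ.⊓-sel ⌈ w / ρ ⌉ cap
  ... | inj₁ eq = inj₂ (w , refl , subst (λ t → w ≤ ρ * t) (sym eq) (m≤n*⌈m/n⌉ w ρ))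
  ... | inj₂ eq = inj₁ (subst (B ≤_) (sym eq) (ℕ.m≤m⊔n B 1))

  module _ {n} (G : WGraph n) (δ : Fin n → Fin n → ℚ) (G-wu : IsWUGraph G) where

    H : WGraph n
    H = ruleGraph rescaledRule G δ

    H-isWUGraph : IsWUGraph H
    H-isWUGraph =
      (λ u v → cong₂ rescaledEdge (does-≟-comm u v) (proj₁ G-wu u v)) ,
      (λ u → cong (λ b → rescaledEdge b (G u u)) (dec-true (u ≟ u) refl)) ,
      (λ u v w′ → rescaledEdge-pos (does (u ≟ v)) (G u v) (proj₂ (proj₂ G-wu) u v))

    H-edge : ∀ {x z w} → G x z ≡ just w → H x z ≡ just (⌈ w / ρ ⌉ ⊓ cap)
    H-edge {x} {z} e = cong₂ rescaledEdge (dec-false (x ≟ z) x≢z) e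
      where
      x≢z : x ≢ z
      x≢z refl with () ← trans (sym e) (proj₁ (proj₂ G-wu) x)

    H-walk-lift : ∀ {x y} (q : Walk H x y) → B ≤ weight q ⊎ Σ (Walk G x y) (λ p → weight p ≤ ρ * weight q)
    H-walk-lift [] = inj₂ ([] , z≤n)
    H-walk-lift (step {u = x} {v = z} w′ e q) with rescaledEdge-lift (does (x ≟ z)) (G x z) e | H-walk-lift q
    ... | inj₁ B≤w′             | _               = inj₁ (ℕ.≤-trans B≤w′ (ℕ.m≤m+n w′ (weight q)))
    ... | inj₂ _                | inj₁ B≤q        = inj₁ (ℕ.≤-trans B≤q (ℕ.m≤n+m (weight q) w′))
    ... | inj₂ (w , e′ , w≤ρw′) | inj₂ (p , p≤ρq) =
      inj₂ (step w e′ p , ℕ.≤-trans (ℕ.+-mono-≤ w≤ρw′ p≤ρq) (ℕ.≤-reflexive (sym (ℕ.*-distribˡ-+ ρ w′ (weight q)))))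

    G-walk-project : ∀ {x y} (p : Walk G x y) →
      Σ (Walk H x y) (λ q → ρ * weight q ≤ weight p + hops p * (ρ ∸ 1))
    G-walk-project [] = [] , ℕ.≤-reflexive (ℕ.*-zeroʳ ρ)
    G-walk-project (step w e p) with G-walk-project p
    ... | q , ρq≤ = step (⌈ w / ρ ⌉ ⊓ cap) (H-edge e) q , (begin
      ρ * (⌈ w / ρ ⌉ ⊓ cap + weight q)                ≡⟨ ℕ.*-distribˡ-+ ρ (⌈ w / ρ ⌉ ⊓ cap) (weight q) ⟩
      ρ * (⌈ w / ρ ⌉ ⊓ cap) + ρ * weight q             ≤⟨ ℕ.+-mono-≤ ρw′≤ ρq≤ ⟩
      (w + (ρ ∸ 1)) + (weight p + hops p * (ρ ∸ 1))   ≡⟨ solve 4 (λ a b c d → (a :+ b) :+ (c :+ d :* b) := (a :+ c) :+ (b :+ d :* b)) refl w (ρ ∸ 1) (weight p) (hops p) ⟩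
      (w + weight p) + suc (hops p) * (ρ ∸ 1)         ∎)
      where
      open ℕ.≤-Reasoning
      open +-*-Solver
      ρw′≤ : ρ * (⌈ w / ρ ⌉ ⊓ cap) ≤ w + (ρ ∸ 1)
      ρw′≤ = ℕ.≤-trans (ℕ.*-monoʳ-≤ ρ (ℕ.m⊓n≤m ⌈ w / ρ ⌉ cap)) (n*⌈m/n⌉≤m+[n∸1] w ρ)

    H-edge-≤cap : ∀ {u v} → u ≢ v → ∃ λ w′ → H u v ≡ just w′ × w′ ≤ cap
    H-edge-≤cap {u} {v} u≢v rewrite dec-false (u ≟ v) u≢v = rescaledEdge-≤cap (G u v)

    H-distance-≤ : ∀ {x y m} (q : Walk H x y) → weight q ≤ m → ∃ λ d → IsDist H x y d × d ≤ m
    H-distance-≤ q q≤m with distance H (proj₂ (proj₂ H-isWUGraph)) q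
    ... | d , x-y , d≤q = d , x-y , ℕ.≤-trans d≤q q≤m

    H-diameter : DiamAtMost H cap
    H-diameter u v with u ≟ v
    ... | yes refl = H-distance-≤ [] z≤n
    ... | no  u≢v  with H-edge-≤cap u≢v
    ...   | w′ , e , w′≤cap = H-distance-≤ (step w′ e []) (subst (_≤ cap) (sym (ℕ.+-identityʳ w′)) w′≤cap)

-- The construction

leastBelow : ∀ {P : ℕ → Set} → Decidable P → ∀ m →
  (Σ (Fin m) λ i → P (toℕ i) × (∀ j → j < toℕ i → ¬ P j)) ⊎ (∀ j → j < m → ¬ P j)
leastBelow P? zero = inj₂ (λ _ ())
leastBelow P? (suc m) with P? 0
... | yes P0 = inj₁ (Fin.zero , P0 , λ _ ())
... | no ¬P0 with leastBelow (P? ∘ suc) m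
...   | inj₁ (i , Pi , below) = inj₁ (Fin.suc i , Pi , λ { zero _ → ¬P0 ; (suc j) (s≤s j<i) → below j j<i })
...   | inj₂ none             = inj₂ λ { zero _ → ¬P0 ; (suc j) (s≤s j<m) → none j j<m }

module Construction (ε : ℚ) .{{_ : Positive ε}} (c n h : ℕ) where

  lastScale : ℕ
  lastScale = c * suc ⌊log₂ n ⌋

  scales : ℕ
  scales = suc lastScale

  B : ℕ
  B = ceil2/ ε * (h * h)

  module Scale (j : ℕ) = Rescaled B (2 ^ j) {{ℕ.m^n≢0 2 j}}

  rules : Fin scales → EdgeRule n
  rules i = Scale.rescaledRule (toℕ i)

  Fits : ℚ → ℕ → Set
  Fits x j = x ℚ.≤ toℚ (2 ^ j * B)

  FirstScale : ℚ → Set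
  FirstScale x = (Σ (Fin scales) λ i → Fits x (toℕ i) × (∀ j → j < toℕ i → ¬ Fits x j))
               ⊎ (∀ j → j < scales → ¬ Fits x j)

  firstScale : ∀ x → FirstScale x
  firstScale x = leastBelow (λ j → x ℚ.≤? toℚ (2 ^ j * B)) scales

  -- The fallback δ(u,v) is only reached by pairs without a short shortest path.
  readOff : ∀ {x} → FirstScale x → (Fin scales → ℚ) → ℚ
  readOff         (inj₁ (i , _)) δsᵤᵥ = toℚ (2 ^ toℕ i) ℚ.* δsᵤᵥ i
  readOff {x = x} (inj₂ _)       _    = x

  estimate : OutRule n scales
  estimate _ _ δᵤ δsᵤ v = readOff (firstScale (δᵤ v)) (λ i → δsᵤ i v)

  scales≤ : scales ≤ suc c * suc ⌊log₂ n ⌋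
  scales≤ = ℕ.+-monoˡ-≤ lastScale (s≤s z≤n)

  -- Scale j − 1 does not fit: h d ≥ δ(u,v) > 2^(j−1) ⌈2/ε⌉ h², so the rounding error h (2^j − 1) is below ε d.
  scale-error< : ∀ {x d} j → (∀ t → t < j → ¬ Fits x t) → x ℚ.≤ toℚ (h * d) → 1 ≤ d →
    toℚ (h * (2 ^ j ∸ 1)) ℚ.< ε ℚ.* toℚ d
  scale-error< {d = d} zero _ _ 1≤d =
    subst (λ m → toℚ m ℚ.< ε ℚ.* toℚ d) (sym (ℕ.*-zeroʳ h))
      (ℚ.positive⁻¹ (ε ℚ.* toℚ d) {{ℚ.pos*pos⇒pos ε (toℚ d) {{toℚ-pos 1≤d}}}})
  scale-error< {x} {d} (suc t) earlier x≤hd _ = begin-strict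
    toℚ (h * (2 ^ suc t ∸ 1))               ≤⟨ toℚ-mono-≤ {h * (2 ^ suc t ∸ 1)} {2 * Z} error≤2Z ⟩
    toℚ (2 * Z)                             ≡⟨ toℚ-* 2 Z ⟩
    toℚ 2 ℚ.* toℚ Z                         ≤⟨ ℚ.*-monoʳ-≤-nonNeg (toℚ Z) {{toℚ-nonNeg Z}} (2≤ε*ceil2/ ε) ⟩
    ε ℚ.* toℚ (ceil2/ ε) ℚ.* toℚ Z          ≡⟨ ℚ.*-assoc ε (toℚ (ceil2/ ε)) (toℚ Z) ⟩
    ε ℚ.* (toℚ (ceil2/ ε) ℚ.* toℚ Z)        ≡⟨ cong (ε ℚ.*_) (toℚ-* (ceil2/ ε) Z) ⟨
    ε ℚ.* toℚ (ceil2/ ε * Z)                <⟨ ℚ.*-monoʳ-<-pos ε (toℚ-mono-< {ceil2/ ε * Z} {d} e*Z<d) ⟩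
    ε ℚ.* toℚ d                             ∎
    where
    open ℚ.≤-Reasoning
    open +-*-Solver
    Z = 2 ^ t * h
    error≤2Z : h * (2 ^ suc t ∸ 1) ≤ 2 * Z
    error≤2Z = ℕ.≤-trans (ℕ.*-monoʳ-≤ h (ℕ.m∸n≤m (2 ^ suc t) 1))
      (ℕ.≤-reflexive (solve 2 (λ h r → h :* (con 2 :* r) := con 2 :* (r :* h)) refl h (2 ^ t)))
    2^t*B<h*d : 2 ^ t * B < h * d
    2^t*B<h*d = toℚ-cancel-< {2 ^ t * B} {h * d} (ℚ.<-≤-trans (ℚ.≰⇒> (earlier t (ℕ.n<1+n t))) x≤hd)
    e*Z<d : ceil2/ ε * Z < d
    e*Z<d = ℕ.*-cancelˡ-< h _ d (subst (_< h * d)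
      (solve 3 (λ r e h → r :* (e :* (h :* h)) := h :* (e :* (r :* h))) refl (2 ^ t) (ceil2/ ε) h) 2^t*B<h*d)

  module _ (G : WGraph n) (δ : Fin n → Fin n → ℚ) (G-wu : IsWUGraph G) (δ-approx : IsApprox (toℚ h) G δ) where

    δ≤h*d : ∀ {u v d} → IsDist G u v d → δ u v ℚ.≤ toℚ (h * d)
    δ≤h*d {u} {v} {d} u-v = ℚ.≤-trans (proj₂ (δ-approx u v d u-v)) (ℚ.≤-reflexive (sym (toℚ-* h d)))

    1≤B : ∀ {u v d} → u ≢ v → IsDist G u v d → 1 ≤ B
    1≤B u≢v u-v = ℕ.*-mono-≤ (1≤ceil2/ ε) (ℕ.*-mono-≤ 1≤h 1≤h)
      where
      1≤h : 1 ≤ h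
      1≤h = toℚ-cancel-≤ {1} {h} (approx-factor≥1 G δ-approx u-v (distance-pos G G-wu u≢v u-v))

    rescaled-diameter : Connected G → ∀ j → DiamAtMost (Scale.H j G δ G-wu) B
    rescaled-diameter connected j u v with Scale.H-diameter j G δ G-wu u v | u ≟ v
    ... | d , u-v , _     | yes refl = d , u-v , ℕ.≤-trans (proj₂ u-v []) z≤n
    ... | d , u-v , d≤cap | no u≢v   =
      d , u-v , ℕ.≤-trans d≤cap (ℕ.≤-reflexive (ℕ.m≥n⇒m⊔n≡m (1≤B u≢v (proj₂ (connected u v)))))

    module _ {u v d} (u-v : IsDist G u v d) (j : ℕ) where

      private
        ρ = 2 ^ j

      d≤2^j*dⱼ : ∀ {dⱼ} → Fits (δ u v) j → IsDist (Scale.H j G δ G-wu) u v dⱼ → d ≤ ρ * dⱼ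
      d≤2^j*dⱼ fits ((q , refl) , _) = [ via-cap , via-lift ]′ (Scale.H-walk-lift j G δ G-wu q)
        where
        via-cap : B ≤ weight q → d ≤ ρ * weight q
        via-cap B≤q = ℕ.≤-trans (toℚ-cancel-≤ {d} {ρ * B} (ℚ.≤-trans (proj₁ (δ-approx u v d u-v)) fits)) (ℕ.*-monoʳ-≤ ρ B≤q)
        via-lift : Σ (Walk G u v) (λ p → weight p ≤ ρ * weight q) → d ≤ ρ * weight q
        via-lift (p , p≤ρq) = ℕ.≤-trans (proj₂ u-v p) p≤ρq

      2^j*dⱼ≤d+error : ∀ {dⱼ} → IsDist (Scale.H j G δ G-wu) u v dⱼ →
        (p : Walk G u v) → weight p ≡ d → hops p ≤ h → ρ * dⱼ ≤ d + h * (ρ ∸ 1)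
      2^j*dⱼ≤d+error (_ , dⱼ-minimal) p refl hops≤h with Scale.G-walk-project j G δ G-wu p
      ... | q , ρq≤ = ℕ.≤-trans (ℕ.*-monoʳ-≤ ρ (dⱼ-minimal q))
        (ℕ.≤-trans ρq≤ (ℕ.+-monoʳ-≤ (weight p) (ℕ.*-monoˡ-≤ (ρ ∸ 1) hops≤h)))

    short-path-fits : WeightsBounded c G → ∀ {u v d} → IsDist G u v d →
      (p : Walk G u v) → weight p ≡ d → hops p ≤ h → Fits (δ u v) lastScale
    short-path-fits bounded {d = d} u-v p refl hops≤h =
      ℚ.≤-trans (δ≤h*d u-v) (toℚ-mono-≤ {h * d} {2 ^ lastScale * B} (begin
        h * d                  ≤⟨ ℕ.*-monoʳ-≤ h (ℕ.≤-trans (weight≤hops*max G bounded p) (ℕ.*-monoˡ-≤ (n ^ c) hops≤h)) ⟩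
        h * (h * n ^ c)        ≡⟨ ℕ.*-assoc h h (n ^ c) ⟨
        (h * h) * n ^ c        ≤⟨ ℕ.*-mono-≤ h*h≤B (n^c≤2^[c*[1+⌊log₂n⌋]] n c) ⟩
        B * 2 ^ lastScale      ≡⟨ ℕ.*-comm B (2 ^ lastScale) ⟩
        2 ^ lastScale * B      ∎))
      where
      open ℕ.≤-Reasoning
      h*h≤B : h * h ≤ B
      h*h≤B = ℕ.≤-trans (ℕ.≤-reflexive (sym (ℕ.*-identityˡ (h * h)))) (ℕ.*-monoˡ-≤ (h * h) (1≤ceil2/ ε))

    module _ {l : ℚ} {δs : Fin scales → Fin n → Fin n → ℚ}
             (δs-approx : ∀ i → IsApprox l (Scale.H (toℕ i) G δ G-wu) (δs i))
             {u v d} (u-v : IsDist G u v d) where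

      private
        dist : Fin scales → ℕ
        dist i = proj₁ (Scale.H-diameter (toℕ i) G δ G-wu u v)

        u-vᵢ : ∀ i → IsDist (Scale.H (toℕ i) G δ G-wu) u v (dist i)
        u-vᵢ i = proj₁ (proj₂ (Scale.H-diameter (toℕ i) G δ G-wu u v))

      readOff-≥ : (s : FirstScale (δ u v)) → toℚ d ℚ.≤ readOff s (λ i → δs i u v)
      readOff-≥ (inj₂ _)              = proj₁ (δ-approx u v d u-v)
      readOff-≥ (inj₁ (i , fits , _)) = begin
        toℚ d                       ≤⟨ toℚ-mono-≤ {d} {ρ * dist i} (d≤2^j*dⱼ u-v (toℕ i) fits (u-vᵢ i)) ⟩
        toℚ (ρ * dist i)            ≡⟨ toℚ-* ρ (dist i) ⟩
        toℚ ρ ℚ.* toℚ (dist i)      ≤⟨ ℚ.*-monoˡ-≤-nonNeg (toℚ ρ) {{toℚ-nonNeg ρ}} (proj₁ (δs-approx i u v (dist i) (u-vᵢ i))) ⟩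
        toℚ ρ ℚ.* δs i u v          ∎
        where
        open ℚ.≤-Reasoning
        ρ = 2 ^ toℕ i

      readOff-< : WeightsBounded c G → u ≢ v → (p : Walk G u v) → weight p ≡ d → hops p ≤ h →
        (s : FirstScale (δ u v)) → readOff s (λ i → δs i u v) ℚ.< (1ℚ ℚ.+ ε) ℚ.* l ℚ.* toℚ d
      readOff-< bounded _ p wp hops≤h (inj₂ none) =
        ⊥-elim (none lastScale (ℕ.n<1+n lastScale) (short-path-fits bounded u-v p wp hops≤h))
      readOff-< bounded u≢v p wp hops≤h (inj₁ (i , _ , earlier)) = begin-strict
        toℚ ρ ℚ.* δs i u v              ≤⟨ ℚ.*-monoˡ-≤-nonNeg (toℚ ρ) {{toℚ-nonNeg ρ}} (proj₂ approxᵢ) ⟩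
        toℚ ρ ℚ.* (l ℚ.* toℚ (dist i))  ≡⟨ solve 3 (λ r l a → r :* (l :* a) := l :* (r :* a)) refl (toℚ ρ) l (toℚ (dist i)) ⟩
        l ℚ.* (toℚ ρ ℚ.* toℚ (dist i))  ≡⟨ cong (l ℚ.*_) (toℚ-* ρ (dist i)) ⟨
        l ℚ.* toℚ (ρ * dist i)          ≤⟨ ℚ.*-monoˡ-≤-nonNeg l {{ℚ.pos⇒nonNeg l {{l>0}}}} (toℚ-mono-≤ {ρ * dist i} {d + error} (2^j*dⱼ≤d+error u-v (toℕ i) (u-vᵢ i) p wp hops≤h)) ⟩
        l ℚ.* toℚ (d + error)           ≡⟨ cong (l ℚ.*_) (toℚ-+ d error) ⟩
        l ℚ.* (toℚ d ℚ.+ toℚ error)     <⟨ *[a+x]<[1+ε]*l*a ε {l} {{l>0}} (scale-error< (toℕ i) earlier (δ≤h*d u-v) 1≤d) ⟩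
        (1ℚ ℚ.+ ε) ℚ.* l ℚ.* toℚ d      ∎
        where
        open ℚ.≤-Reasoning
        open ℚ-Solver.+-*-Solver
        ρ = 2 ^ toℕ i
        error = h * (ρ ∸ 1)
        approxᵢ = δs-approx i u v (dist i) (u-vᵢ i)
        1≤d : 1 ≤ d
        1≤d = distance-pos G G-wu u≢v u-v
        l>0 : Positive l
        l>0 = ℚ.positive (ℚ.<-≤-trans (ℚ.positive⁻¹ 1ℚ) (approx-factor≥1 (Scale.H (toℕ i) G δ G-wu) {l} {δs i} (δs-approx i) (u-vᵢ i)
                (distance-pos (Scale.H (toℕ i) G δ G-wu) (Scale.H-isWUGraph (toℕ i) G δ G-wu) u≢v (u-vᵢ i))))

lemma8p2 : (ε : ℚ) .{{_ : Positive ε}} (c : ℕ) →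
    ∃[ C ] ∀ (n h : ℕ) →
      ∃[ k ] (k ≤ C * suc ⌊log₂ n ⌋) ×
      Σ (Fin k → EdgeRule n) (λ E →
        (∀ (G : WGraph n) (δ : Fin n → Fin n → ℚ) →
          IsWUGraph G → Connected G → WeightsBounded c G → IsApprox (toℚ h) G δ →
          ∀ (i : Fin k) →
            IsWUGraph (ruleGraph (E i) G δ) ×
            DiamAtMost (ruleGraph (E i) G δ) (ceil2/ ε * (h * h)))
        ×
        (∀ (l : ℚ) → Σ (OutRule n k) (λ F →
          ∀ (G : WGraph n) (δ : Fin n → Fin n → ℚ) →
            IsWUGraph G → Connected G → WeightsBounded c G → IsApprox (toℚ h) G δ →
            ∀ (δs : Fin k → Fin n → Fin n → ℚ) →
            (∀ (i : Fin k) → IsApprox l (ruleGraph (E i) G δ) (δs i)) →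
            ∀ (u v : Fin n) (d : ℕ) → IsDist G u v d →
              (toℚ d ℚ.≤ F u (G u) (δ u) (λ i → δs i u) v) ×
              (u ≢ v → (Σ (Walk G u v) (λ p → (weight p ≡ d) × (hops p ≤ h))) →
                F u (G u) (δ u) (λ i → δs i u) v ℚ.< (1ℚ ℚ.+ ε) ℚ.* l ℚ.* toℚ d))))
lemma8p2 ε c = suc c , λ n h → let open Construction ε c n h in
  scales , scales≤ , rules ,
  (λ G δ G-wu connected _ δ-approx i →
    Scale.H-isWUGraph (toℕ i) G δ G-wu , rescaled-diameter G δ G-wu δ-approx connected (toℕ i)) ,
  λ l → estimate , λ G δ G-wu _ bounded δ-approx δs δs-approx u v d u-v →
    readOff-≥ G δ G-wu δ-approx {l} {δs} δs-approx u-v (firstScale (δ u v)) ,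
    λ { u≢v (p , wp , hops≤h) → readOff-< G δ G-wu δ-approx {l} {δs} δs-approx u-v bounded u≢v p wp hops≤h (firstScale (δ u v)) }
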